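{- Let $\mathbb{H}$ be the hexahedron (cube) graph, i.e., the graph formed by the $8$ vertices and $12$ edges of a cube. Then $k(\mathbb{H})=6$.
   Context: All graphs are simple and undirected. The competition graph $C(D)$ of a digraph $D$ is the graph with vertex set $V(D)$ in which two distinct vertices $x,y$ are adjacent if and only if there is a vertex $v$ with $(x,v)$ and $(y,v)$ both arcs of $D$. The competition number $k(G)$ of a graph $G$ is the minimum integer $k\ge 0$ such that $G$ together with $k$ new isolated vertices is the competition graph of some acyclic digraph. -}

module Defs where

open import Data.Nat using (ℕ; _+_; _<_)
open import Data.Fin using (Fin; splitAt; toℕ)
open import Data.Nat using (_≡ᵇ_)
open import Data.Bool using (Bool; true; false; _∧_; _∨_; T)
open import Data.Sum using (_⊎_; inj₁; inj₂)
open import Data.Product using (_×_; _,_; ∃)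
open import Data.List using (List; []; _∷_)
open import Data.Bool.ListAction using (any)
open import Relation.Nullary using (¬_; does)
open import Relation.Binary.PropositionalEquality using (_≡_)
open import Relation.Binary.Construct.Closure.Transitive using (TransClosure)

-- A simple graph on vertex set Fin n, given by a (symmetric, irreflexive) Bool adjacency.
Graph : ℕ → Set
Graph n = Fin n → Fin n → Bool

Digraph : ℕ → Set
Digraph n = Fin n → Fin n → Bool

Arc : ∀ {n} → Digraph n → Fin n → Fin n → Set
Arc D x y = T (D x y)

Acyclic : ∀ {n} → Digraph n → Set
Acyclic {n} D = ∀ (x : Fin n) → ¬ TransClosure (Arc D) x x

CompAdj : ∀ {n} → Digraph n → Fin n → Fin n → Set
CompAdj {n} D x y = ¬ (x ≡ y) × ∃ λ (v : Fin n) → Arc D x v × Arc D y v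

addIsolated : ∀ {n} → Graph n → (k : ℕ) → Graph (n + k)
addIsolated {n} G k x y with splitAt n x | splitAt n y
... | inj₁ i | inj₁ j = G i j
... | _      | _      = false

IsCompetitionGraphOf : ∀ {n} → Graph n → Digraph n → Set
IsCompetitionGraphOf {n} H D =
  ∀ (x y : Fin n) → (T (H x y) → CompAdj D x y) × (CompAdj D x y → T (H x y))

CompetitionRealizable : ∀ {n} → Graph n → ℕ → Set
CompetitionRealizable {n} G k =
  ∃ λ (D : Digraph (n + k)) → Acyclic D × IsCompetitionGraphOf (addIsolated G k) D

CompetitionNumberIs : ∀ {n} → Graph n → ℕ → Set
CompetitionNumberIs G k =
  CompetitionRealizable G k × (∀ (j : ℕ) → j < k → ¬ CompetitionRealizable G j)

-- The cube graph Q₃: vertex i ∈ {0..7} read as a 3-bit string; edges join strings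
-- differing in exactly one bit (12 edges).
private
  edge : ℕ → ℕ → Fin 8 → Fin 8 → Bool
  edge a b x y = ((a ≡ᵇ toℕ x) ∧ (b ≡ᵇ toℕ y)) ∨ ((a ≡ᵇ toℕ y) ∧ (b ≡ᵇ toℕ x))

cubeEdges : List (ℕ × ℕ)
cubeEdges =
  (0 , 1) ∷ (0 , 2) ∷ (0 , 4) ∷ (1 , 3) ∷ (1 , 5) ∷ (2 , 3) ∷
  (2 , 6) ∷ (3 , 7) ∷ (4 , 5) ∷ (4 , 6) ∷ (5 , 7) ∷ (6 , 7) ∷ []

hexahedron : Graph 8
hexahedron x y = any (λ { (a , b) → edge a b x y }) cubeEdges

module Submission where

-- Upper bound: an explicit acyclic digraph on the cube plus six isolated vertices, checked by
-- evaluation. Lower bound: the cube is triangle-free, so in a realisation its 12 edges have 12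
-- distinct common preys (a vertex preyed on by two edges would make their endpoints a clique).
-- An acyclic digraph has a source s and a vertex t whose only possible in-neighbour is s; neither
-- is a common prey of two distinct vertices, hence 12 + 2 ≤ 8 + k.

open import Defs
open import Data.Nat using (ℕ; zero; suc; _+_; _≤_; _<_; _<′_; <′-base; <′-step)
open import Data.Nat.Properties using (<⇒<′; n<1+n; <⇒≱; +-monoʳ-<)
open import Data.Fin using (Fin; zero; suc; toℕ; _↑ˡ_; _↑ʳ_; splitAt; #_; _≟_; _<?_)
  renaming (_<_ to _<ᶠ_)
open import Data.Fin.Properties
  using (splitAt-↑ˡ; ↑ˡ-injective; pigeonhole; any?; all?; ¬∀⟶∃¬; injective⇒≤; <-trans; <-irrefl)
open import Data.Bool using (T)
open import Data.Unit using (⊤; tt)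
open import Data.Empty using (⊥-elim)
open import Data.Sum using (_⊎_; inj₁; inj₂) renaming (map to map-⊎)
open import Data.Product using (_×_; _,_; ∃; ∃₂; Σ; proj₁; proj₂) renaming (map to map-×)
open import Data.Vec using (lookup; _∷_; [])
open import Function.Definitions using (Injective)
open import Level using (0ℓ)
open import Relation.Unary using (Pred; Decidable)
open import Relation.Nullary using (¬_; Dec; yes; no; does)
open import Relation.Nullary.Decidable
  using (T?; ¬?; _×-dec_; _⊎-dec_; _→-dec_; from-yes; decidable-stable)
open import Relation.Binary.PropositionalEquality using (_≡_; _≢_; refl; sym; trans; subst)
open import Relation.Binary.Construct.Closure.Transitive using (TransClosure; [_]; _∷_)

private
  variable
    n m k : ℕ

TwoInNeighbours : Digraph n → Fin n → Set
TwoInNeighbours D v = ∃₂ λ x y → x ≢ y × Arc D x v × Arc D y v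

module BackwardWalk (D : Digraph n) (P : Pred (Fin n) 0ℓ)
  (back : ∀ {x} → P x → ∃ λ y → P y × Arc D y x) (start : Σ (Fin n) P) where

  step : Σ (Fin n) P → Σ (Fin n) P
  step (x , px) = proj₁ (back px) , proj₁ (proj₂ (back px))

  step-arc : ∀ w → Arc D (proj₁ (step w)) (proj₁ w)
  step-arc (x , px) = proj₂ (proj₂ (back px))

  walk : ℕ → Σ (Fin n) P
  walk zero    = start
  walk (suc i) = step (walk i)

  vertex : ℕ → Fin n
  vertex i = proj₁ (walk i)

  vertex-path : ∀ {i j} → i <′ j → TransClosure (Arc D) (vertex j) (vertex i)
  vertex-path {i} <′-base         = [ step-arc (walk i) ]
  vertex-path     (<′-step {j} p) = step-arc (walk j) ∷ vertex-path p

  cycle : ∃ λ z → TransClosure (Arc D) z z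
  cycle with i , j , i<j , vi≡vj ← pigeonhole (n<1+n n) (λ i → vertex (toℕ i))
    = vertex (toℕ i)
    , subst (λ z → TransClosure (Arc D) z _) (sym vi≡vj) (vertex-path (<⇒<′ i<j))

acyclic⇒minimal : {D : Digraph n} → Acyclic D → (P : Pred (Fin n) 0ℓ) → Decidable P →
                  ∀ {x} → P x → ∃ λ y → P y × (∀ z → P z → ¬ Arc D z y)
acyclic⇒minimal {n} {D} acyclic P P? {x} px = minimal (¬∀⟶∃¬ n Q Q? ¬backwardClosed)
  where
  Q : Pred (Fin n) 0ℓ
  Q y = P y → ∃ λ z → P z × Arc D z y

  Q? : Decidable Q
  Q? y = P? y →-dec any? (λ z → P? z ×-dec T? (D z y))

  ¬backwardClosed : ¬ (∀ y → Q y)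
  ¬backwardClosed allQ = let z , c = BackwardWalk.cycle D P (allQ _) (x , px) in acyclic z c

  minimal : (∃ λ y → ¬ Q y) → ∃ λ y → P y × (∀ z → P z → ¬ Arc D z y)
  minimal (y , ¬Qy) = y , decidable-stable (P? y) (λ ¬py → ¬Qy (λ py → ⊥-elim (¬py py)))
                        , λ z pz z→y → ¬Qy (λ _ → z , pz , z→y)

acyclic⇒commonPreys+2≤ : {D : Digraph n} → Acyclic D → (g : Fin (suc m) → Fin n) →
                         Injective _≡_ _≡_ g → (∀ i → TwoInNeighbours D (g i)) → 2 + suc m ≤ n
acyclic⇒commonPreys+2≤ {n} {m} {D} acyclic g g-injective two = injective⇒≤ h-injective
  where
  source : ∃ λ s → ∀ x → ¬ Arc D x s
  source with s , _ , s-minimal ← acyclic⇒minimal acyclic (λ _ → ⊤) (λ _ → yes tt) {g zero} tt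
    = s , λ x → s-minimal x tt

  s : Fin n
  s = proj₁ source

  g≢s : ∀ i → g i ≢ s
  g≢s i gi≡s with x , _ , _ , x→gi , _ ← two i = proj₂ source x (subst (Arc D x) gi≡s x→gi)

  nextSource : ∃ λ t → t ≢ s × ∀ {x} → Arc D x t → x ≡ s
  nextSource with t , t≢s , t-minimal ← acyclic⇒minimal acyclic (_≢ s) (λ x → ¬? (x ≟ s)) (g≢s zero)
    = t , t≢s , λ {x} x→t → decidable-stable (x ≟ s) (λ x≢s → t-minimal x x≢s x→t)

  t : Fin n
  t = proj₁ nextSource

  t≢s : t ≢ s
  t≢s = proj₁ (proj₂ nextSource)

  into-t⇒≡s : ∀ {x} → Arc D x t → x ≡ s
  into-t⇒≡s = proj₂ (proj₂ nextSource)

  g≢t : ∀ i → g i ≢ t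
  g≢t i gi≡t with x , y , x≢y , x→gi , y→gi ← two i =
    x≢y (trans (into-t⇒≡s (subst (Arc D x) gi≡t x→gi))
               (sym (into-t⇒≡s (subst (Arc D y) gi≡t y→gi))))

  h : Fin (2 + suc m) → Fin n
  h zero          = s
  h (suc zero)    = t
  h (suc (suc i)) = g i

  h-injective : Injective _≡_ _≡_ h
  h-injective {zero}        {zero}        _ = refl
  h-injective {zero}        {suc zero}    e = ⊥-elim (t≢s (sym e))
  h-injective {zero}        {suc (suc j)} e = ⊥-elim (g≢s j (sym e))
  h-injective {suc zero}    {zero}        e = ⊥-elim (t≢s e)
  h-injective {suc zero}    {suc zero}    _ = refl
  h-injective {suc zero}    {suc (suc j)} e = ⊥-elim (g≢t j (sym e))
  h-injective {suc (suc i)} {zero}        e = ⊥-elim (g≢s i e)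
  h-injective {suc (suc i)} {suc zero}    e = ⊥-elim (g≢t i e)
  h-injective {suc (suc i)} {suc (suc j)} e with refl ← g-injective e = refl

TriangleFree : Graph n → Set
TriangleFree G = ∀ x y z → ¬ (T (G x y) × T (G y z) × T (G x z))

addIsolated-↑ˡ : (G : Graph n) (x y : Fin n) → addIsolated G k (x ↑ˡ k) (y ↑ˡ k) ≡ G x y
addIsolated-↑ˡ {n} {k} G x y rewrite splitAt-↑ˡ n x k | splitAt-↑ˡ n y k = refl

addIsolated-triangleFree : {G : Graph n} → TriangleFree G → TriangleFree (addIsolated G k)
addIsolated-triangleFree {n} tf x y z with splitAt n x | splitAt n y | splitAt n z
... | inj₁ x′ | inj₁ y′ | inj₁ z′ = tf x′ y′ z′
... | inj₁ _  | inj₁ _  | inj₂ _  = λ ()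
... | inj₁ _  | inj₂ _  | _       = λ ()
... | inj₂ _  | _       | _       = λ ()

IsEdge : Graph n → Fin n × Fin n → Set
IsEdge G e = T (G (proj₁ e) (proj₂ e))

_∈ₑ_ : Fin n → Fin n × Fin n → Set
x ∈ₑ e = x ≡ proj₁ e ⊎ x ≡ proj₂ e

_∈ₑ?_ : (x : Fin n) (e : Fin n × Fin n) → Dec (x ∈ₑ e)
x ∈ₑ? e = (x ≟ proj₁ e) ⊎-dec (x ≟ proj₂ e)

DistinctEdges : (Fin m → Fin n × Fin n) → Set
DistinctEdges e = ∀ i j → proj₁ (e j) ∈ₑ e i → proj₂ (e j) ∈ₑ e i → i ≡ j

commonPrey⇒edge : {H : Graph n} {D : Digraph n} → IsCompetitionGraphOf H D →
                  ∀ {x y v} → x ≢ y → Arc D x v → Arc D y v → T (H x y)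
commonPrey⇒edge C {x} {y} {v} x≢y x→v y→v = proj₂ (C x y) (x≢y , v , x→v , y→v)

triangleFree⇒commonPrey-unique : {H : Graph n} {D : Digraph n} → TriangleFree H →
                                 IsCompetitionGraphOf H D → ∀ {x y z v} → x ≢ y →
                                 Arc D x v → Arc D y v → Arc D z v → z ∈ₑ (x , y)
triangleFree⇒commonPrey-unique tf C {x} {y} {z} x≢y x→v y→v z→v with z ≟ x | z ≟ y
... | yes z≡x | _       = inj₁ z≡x
... | no _    | yes z≡y = inj₂ z≡y
... | no z≢x  | no z≢y  = ⊥-elim (tf x y z ( commonPrey⇒edge C x≢y x→v y→v
                                            , commonPrey⇒edge C (λ y≡z → z≢y (sym y≡z)) y→v z→v
                                            , commonPrey⇒edge C (λ x≡z → z≢x (sym x≡z)) x→v z→v))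

triangleFree-realizable⇒edges+2≤ : {G : Graph n} → TriangleFree G → (e : Fin (suc m) → Fin n × Fin n) →
                                   (∀ i → IsEdge G (e i)) → DistinctEdges e →
                                   CompetitionRealizable G k → 2 + suc m ≤ n + k
triangleFree-realizable⇒edges+2≤ {n} {m} {k} {G} tf e e-edge e-distinct (D , acyclic , C) =
  acyclic⇒commonPreys+2≤ acyclic prey prey-injective prey-twoInNeighbours
  where
  ι : Fin n → Fin (n + k)
  ι x = x ↑ˡ k

  prey-of : ∀ i → CompAdj D (ι (proj₁ (e i))) (ι (proj₂ (e i)))
  prey-of i = proj₁ (C _ _) (subst T (sym (addIsolated-↑ˡ G _ _)) (e-edge i))

  prey : Fin (suc m) → Fin (n + k)
  prey i = proj₁ (proj₂ (prey-of i))

  prey-twoInNeighbours : ∀ i → TwoInNeighbours D (prey i)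
  prey-twoInNeighbours i with a≢b , _ , a→v , b→v ← prey-of i = _ , _ , a≢b , a→v , b→v

  preyedOnlyByEndpoints : ∀ i {x} → Arc D (ι x) (prey i) → x ∈ₑ e i
  preyedOnlyByEndpoints i x→v with a≢b , _ , a→v , b→v ← prey-of i =
    map-⊎ (↑ˡ-injective k _ _) (↑ˡ-injective k _ _)
      (triangleFree⇒commonPrey-unique (addIsolated-triangleFree tf) C a≢b a→v b→v x→v)

  prey-injective : Injective _≡_ _≡_ prey
  prey-injective {i} {j} pi≡pj with _ , _ , a→v , b→v ← prey-of j =
    e-distinct i j (preyedOnlyByEndpoints i (subst (Arc D _) (sym pi≡pj) a→v))
                   (preyedOnlyByEndpoints i (subst (Arc D _) (sym pi≡pj) b→v))

isCompetitionGraphOf? : (H : Graph n) (D : Digraph n) → Dec (IsCompetitionGraphOf H D)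
isCompetitionGraphOf? H D =
  all? λ x → all? λ y → (T? (H x y) →-dec compAdj? x y) ×-dec (compAdj? x y →-dec T? (H x y))
  where
  compAdj? : ∀ x y → Dec (CompAdj D x y)
  compAdj? x y = ¬? (x ≟ y) ×-dec any? (λ v → T? (D x v) ×-dec T? (D y v))

increasing⇒acyclic : {D : Digraph n} → (∀ x y → Arc D x y → x <ᶠ y) → Acyclic D
increasing⇒acyclic {D = D} increasing x cycle = <-irrefl refl (path-increasing cycle)
  where
  path-increasing : ∀ {x y} → TransClosure (Arc D) x y → x <ᶠ y
  path-increasing [ x→y ]   = increasing _ _ x→y
  path-increasing (x→y ∷ p) = <-trans (increasing _ _ x→y) (path-increasing p)

cubeEdge : Fin 12 → Fin 8 × Fin 8
cubeEdge = lookup ( (# 0 , # 1) ∷ (# 0 , # 2) ∷ (# 1 , # 3) ∷ (# 2 , # 3) ∷ (# 0 , # 4) ∷ (# 1 , # 5)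
                  ∷ (# 4 , # 5) ∷ (# 2 , # 6) ∷ (# 4 , # 6) ∷ (# 3 , # 7) ∷ (# 5 , # 7) ∷ (# 6 , # 7) ∷ [])

cubeEdge-edge : ∀ i → IsEdge hexahedron (cubeEdge i)
cubeEdge-edge = from-yes (all? λ i → T? (hexahedron (proj₁ (cubeEdge i)) (proj₂ (cubeEdge i))))

cubeEdge-distinct : DistinctEdges cubeEdge
cubeEdge-distinct = from-yes (all? λ i → all? λ j →
  (proj₁ (cubeEdge j) ∈ₑ? cubeEdge i) →-dec (proj₂ (cubeEdge j) ∈ₑ? cubeEdge i) →-dec (i ≟ j))

hexahedron-triangleFree : TriangleFree hexahedron
hexahedron-triangleFree =
  from-yes (all? λ x → all? λ y → all? λ z → ¬? (T? (hexahedron x y) ×-dec T? (hexahedron y z) ×-dec T? (hexahedron x z)))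

-- Edge i preys on vertex i + 2, which lies above both of its endpoints; vertices 8 to 13 are the
-- six added isolated vertices.
cubeDigraph : Digraph 14
cubeDigraph x y = does (any? λ i → (x ∈ₑ? map-× (_↑ˡ 6) (_↑ˡ 6) (cubeEdge i)) ×-dec (y ≟ 2 ↑ʳ i))

cubeDigraph-acyclic : Acyclic cubeDigraph
cubeDigraph-acyclic = increasing⇒acyclic (from-yes (all? λ x → all? λ y → T? (cubeDigraph x y) →-dec (x <? y)))

cubeDigraph-competitionGraph : IsCompetitionGraphOf (addIsolated hexahedron 6) cubeDigraph
cubeDigraph-competitionGraph = from-yes (isCompetitionGraphOf? (addIsolated hexahedron 6) cubeDigraph)

theorem2p2 : CompetitionNumberIs hexahedron 6
theorem2p2 = (cubeDigraph , cubeDigraph-acyclic , cubeDigraph-competitionGraph) , lowerBound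
  where
  lowerBound : ∀ j → j < 6 → ¬ CompetitionRealizable hexahedron j
  lowerBound j j<6 realizable = <⇒≱ (+-monoʳ-< 8 j<6)
    (triangleFree-realizable⇒edges+2≤ hexahedron-triangleFree cubeEdge cubeEdge-edge cubeEdge-distinct realizable)
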